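{- Let $\mathcal{R}=\mathbb{F}_{q_1}\oplus\cdots\oplus\mathbb{F}_{q_r}$ and $k\ge 1$. Then \[ P(k,\mathcal{R})=\{\mathrm{lcm}(\omega_1,\dots,\omega_r) : \omega_i\in P(k,\mathbb{F}_{q_i}) \text{ for } 1\le i\le r\}. \]
   Context: Here $\mathbb{F}_{q_i}$ are finite fields (possibly of different characteristics). For a finite commutative ring $R$, a sequence $\mathbf{a}=(a_n)_{n\ge0}$ over $R$ satisfies a linear recurrence of degree $k$ if there are $c_0,\dots,c_{k-1}\in R$ with $c_0$ a unit of $R$ such that $a_{n+k}=\sum_{i=0}^{k-1}c_ia_{n+i}$ for all $n\ge0$. Its period $\rho(\mathbf{a})$ is the least $m>0$ with $a_{n+m}=a_n$ for all sufficiently large $n$. $P(k,R)$ denotes the set of periods of all sequences over $R$ satisfying a linear recurrence of degree $k$. -}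

module Defs where

open import Level using (0ℓ)
open import Algebra.Bundles using (CommutativeRing)
import Algebra.Construct.DirectProduct as DP
open import Data.Nat using (ℕ; zero; suc; _+_; _≤_; _<_)
open import Data.Nat.LCM using (lcm)
open import Data.Fin using (Fin; toℕ) renaming (zero to fzero; suc to fsuc)
open import Data.Product using (Σ; ∃; _×_)
open import Data.Empty using (⊥)
open import Relation.Nullary using (¬_)
open import Relation.Binary.PropositionalEquality using (_≡_)

record FiniteField : Set₁ where
  field
    ring : CommutativeRing 0ℓ 0ℓ
  open CommutativeRing ring
  field
    size        : ℕ
    enum        : Fin size → Carrier
    enum-surj   : ∀ x → ∃ λ i → enum i ≈ x
    enum-inj    : ∀ i j → enum i ≈ enum j → i ≡ j
    one≉zero    : ¬ (1# ≈ 0#)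
    inverse     : ∀ x → ¬ (x ≈ 0#) → ∃ λ y → x * y ≈ 1#

⨁ : ∀ {r} → (Fin (suc r) → FiniteField) → CommutativeRing 0ℓ 0ℓ
⨁ {zero}  F = FiniteField.ring (F fzero)
⨁ {suc r} F = DP.commutativeRing (FiniteField.ring (F fzero)) (⨁ (λ i → F (fsuc i)))

lcmAll : ∀ {n} → (Fin n → ℕ) → ℕ
lcmAll {zero}  ω = 1
lcmAll {suc n} ω = lcm (ω fzero) (lcmAll (λ i → ω (fsuc i)))

module _ (R : CommutativeRing 0ℓ 0ℓ) where
  open CommutativeRing R using (Carrier; _≈_; 0#; 1#) renaming (_+_ to _⊕_; _*_ to _⊛_)

  finSum : ∀ {k} → (Fin k → Carrier) → Carrier
  finSum {zero}  f = 0#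
  finSum {suc k} f = f fzero ⊕ finSum (λ i → f (fsuc i))

  IsUnit : Carrier → Set
  IsUnit x = ∃ λ y → x ⊛ y ≈ 1#

  -- "c₀ is a unit"; for k = 0 there is no c₀, so no recurrence of degree 0.
  LeadUnit : (k : ℕ) → (Fin k → Carrier) → Set
  LeadUnit zero    c = ⊥
  LeadUnit (suc k) c = IsUnit (c fzero)

  SatisfiesLinRec : ℕ → (ℕ → Carrier) → Set
  SatisfiesLinRec k a =
    Σ (Fin k → Carrier) λ c → LeadUnit k c ×
      (∀ n → a (n + k) ≈ finSum (λ i → c i ⊛ a (n + toℕ i)))

  EventuallyPeriodic : (ℕ → Carrier) → ℕ → Set
  EventuallyPeriodic a m = 0 < m × ∃ λ N → ∀ n → N ≤ n → a (n + m) ≈ a n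

  IsPeriodOf : (ℕ → Carrier) → ℕ → Set
  IsPeriodOf a m = EventuallyPeriodic a m × (∀ m' → EventuallyPeriodic a m' → m ≤ m')

  InP : ℕ → ℕ → Set
  InP k m = ∃ λ a → SatisfiesLinRec k a × IsPeriodOf a m

{-# OPTIONS --safe #-}
-- A sequence over R ⊕ S satisfies a recurrence of degree k iff both components do (pair the
-- coefficient vectors), and it is eventually m-periodic iff both components are. The eventual
-- periods of a sequence are exactly the positive multiples of its least period, so the least
-- period of a pair of sequences is the lcm of the least periods of its components. Least periods
-- exist over direct sums of finite fields because equality is decidable and, once some period m
-- is known, whether m' is a period can be tested on a single window of length m. Induction on
-- the number of summands then gives the theorem.
module Submission where

open import Level using (0ℓ)
open import Algebra.Bundles using (CommutativeRing)
import Algebra.Construct.DirectProduct as DP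
open import Data.Nat using (ℕ; zero; suc; _+_; _*_; _∸_; _⊔_; _≤_; _<_; NonZero; >-nonZero; _≟_; _<?_; anyUpTo?; allUpTo?)
open import Data.Nat.Properties
open import Algebra.Properties.CommutativeSemigroup +-commutativeSemigroup using (x∙yz≈xz∙y; xy∙z≈xz∙y)
open import Data.Nat.DivMod using (_%_; _/_; m%n<n; m≡m%n+[m/n]*n)
open import Data.Nat.Divisibility using (_∣_; divides; m%n≡0⇒n∣m; ∣⇒≤; ∣-antisym; ∣-refl; 1∣_; 0∣⇒≡0; m∣m*n; n∣m*n)
open import Data.Nat.Induction using (<-rec)
open import Data.Nat.LCM using (lcm; m∣lcm[m,n]; n∣lcm[m,n]; lcm-least)
open import Data.Fin using (Fin; toℕ) renaming (zero to fzero; suc to fsuc)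
import Data.Fin.Properties as Fin
open import Data.Vec.Functional using (_∷_)
open import Data.Product using (∃; ∃₂; _×_; _,_; proj₁; proj₂; <_,_>)
open import Function using (_∘_)
open import Function.Bundles using (_⇔_; mk⇔; Equivalence)
import Function.Properties.Equivalence as ⇔
open import Relation.Nullary using (Dec; yes; no; contradiction)
open import Relation.Nullary.Decidable using (map′; _×-dec_)
import Relation.Unary as U
open import Relation.Binary.Definitions using (Decidable)
open import Relation.Binary.PropositionalEquality using (_≡_; refl; sym; trans; cong; subst)
open import Defs

Least : (ℕ → Set) → ℕ → Set
Least P m = P m × (∀ k → P k → m ≤ k)

least-satisfying : {P : ℕ → Set} → U.Decidable P → ∀ {n} → P n → ∃ (Least P)
least-satisfying {P} P? {n} = <-rec (λ n → P n → ∃ (Least P)) search n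
  where
  search : ∀ n → (∀ {k} → k < n → P k → ∃ (Least P)) → P n → ∃ (Least P)
  search n smaller Pn with anyUpTo? P? n
  ... | yes (k , k<n , Pk) = smaller k<n Pk
  ... | no ¬P<n            = n , Pn , λ k Pk → ≮⇒≥ λ k<n → ¬P<n (k , k<n , Pk)

lcm-positive : ∀ {m n} → 0 < m → 0 < n → 0 < lcm m n
lcm-positive {suc m} {suc n} _ _ = n≢0⇒n>0 λ lcm≡0 →
  1+n≢0 (0∣⇒≡0 (subst (_∣ suc m * suc n) lcm≡0 (lcm-least (m∣m*n {suc m} (suc n)) (n∣m*n (suc m) {suc n}))))

lcm[n,1]≡n : ∀ n → lcm n 1 ≡ n
lcm[n,1]≡n n = ∣-antisym (lcm-least ∣-refl (1∣ n)) (m∣lcm[m,n] n 1)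

module Periodicity (R : CommutativeRing 0ℓ 0ℓ) where
  open CommutativeRing R using (Carrier; _≈_; setoid; reflexive) renaming (sym to ≈-sym)
  open import Relation.Binary.Reasoning.Setoid setoid

  PeriodicFrom : ℕ → (ℕ → Carrier) → ℕ → Set
  PeriodicFrom N a m = ∀ n → N ≤ n → a (n + m) ≈ a n

  periodicFrom-iterate : ∀ {N a m} → PeriodicFrom N a m → ∀ q {n} → N ≤ n → a (n + q * m) ≈ a n
  periodicFrom-iterate {a = a} p zero    {n} _   = reflexive (cong a (+-identityʳ n))
  periodicFrom-iterate {a = a} {m} p (suc q) {n} N≤n = begin
    a (n + (m + q * m)) ≡⟨ cong a (x∙yz≈xz∙y n m (q * m)) ⟩
    a (n + q * m + m)   ≈⟨ p (n + q * m) (≤-trans N≤n (m≤m+n n (q * m))) ⟩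
    a (n + q * m)       ≈⟨ periodicFrom-iterate p q N≤n ⟩
    a n                 ∎

  periodic-multiple : ∀ {a ρ M} → EventuallyPeriodic R a ρ → ρ ∣ M → 0 < M → EventuallyPeriodic R a M
  periodic-multiple (_ , N , p) (divides q refl) 0<M = 0<M , N , λ n N≤n → periodicFrom-iterate p q N≤n

  period-divides : ∀ {a ρ m} → IsPeriodOf R a ρ → EventuallyPeriodic R a m → ρ ∣ m
  period-divides {a} {ρ} {m} ((0<ρ , N , pρ) , minimal) (_ , N' , pm) = by-remainder (m % ρ ≟ 0)
    where
    instance ρ≢0 : NonZero ρ
             ρ≢0 = >-nonZero 0<ρ
    remainder-periodicFrom : PeriodicFrom (N ⊔ N') a (m % ρ)
    remainder-periodicFrom n le = begin
      a (n + m % ρ)              ≈⟨ ≈-sym (periodicFrom-iterate pρ (m / ρ) (≤-trans (m⊔n≤o⇒m≤o N N' le) (m≤m+n n (m % ρ)))) ⟩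
      a (n + m % ρ + m / ρ * ρ)  ≡⟨ cong a (trans (+-assoc n (m % ρ) _) (cong (n +_) (sym (m≡m%n+[m/n]*n m ρ)))) ⟩
      a (n + m)                  ≈⟨ pm n (m⊔n≤o⇒n≤o N N' le) ⟩
      a n                        ∎
    by-remainder : Dec (m % ρ ≡ 0) → ρ ∣ m
    by-remainder (yes r≡0) = m%n≡0⇒n∣m m ρ r≡0
    by-remainder (no r≢0)  =
      contradiction (minimal (m % ρ) (n≢0⇒n>0 r≢0 , N ⊔ N' , remainder-periodicFrom)) (<⇒≱ (m%n<n m ρ))

  period-unique : ∀ {a m m'} → IsPeriodOf R a m → IsPeriodOf R a m' → m ≡ m'
  period-unique (pm , minimal) (pm' , minimal') = ≤-antisym (minimal _ pm') (minimal' _ pm)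

  module Window {a : ℕ → Carrier} {N m : ℕ} .{{_ : NonZero m}} (periodic : PeriodicFrom N a m) where

    PeriodicOnWindow : ℕ → Set
    PeriodicOnWindow m' = ∀ {t} → t < m → a (N + t + m') ≈ a (N + t)

    periodicOnWindow? : Decidable _≈_ → U.Decidable PeriodicOnWindow
    periodicOnWindow? _≈?_ m' = allUpTo? (λ t → a (N + t + m') ≈? a (N + t)) m

    periodicOnWindow⇒periodicFrom : ∀ {m'} → PeriodicOnWindow m' → PeriodicFrom N a m'
    periodicOnWindow⇒periodicFrom {m'} w n N≤n = begin
      a (n + m')             ≡⟨ cong a (trans (cong (_+ m') (sym n≡N+r+q*m)) (xy∙z≈xz∙y (N + r) (q * m) m')) ⟩
      a (N + r + m' + q * m) ≈⟨ periodicFrom-iterate periodic q (≤-trans (m≤m+n N r) (m≤m+n (N + r) m')) ⟩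
      a (N + r + m')         ≈⟨ w (m%n<n (n ∸ N) m) ⟩
      a (N + r)              ≈⟨ ≈-sym (periodicFrom-iterate periodic q (m≤m+n N r)) ⟩
      a (N + r + q * m)      ≡⟨ cong a n≡N+r+q*m ⟩
      a n                    ∎
      where
      r = (n ∸ N) % m
      q = (n ∸ N) / m
      n≡N+r+q*m : N + r + q * m ≡ n
      n≡N+r+q*m = trans (+-assoc N r (q * m))
                        (trans (cong (N +_) (sym (m≡m%n+[m/n]*n (n ∸ N) m))) (m+[n∸m]≡n N≤n))

    periodicFrom⇒periodicOnWindow : ∀ {N' m'} → PeriodicFrom N' a m' → PeriodicOnWindow m'
    periodicFrom⇒periodicOnWindow {N'} {m'} p' {t} _ = begin
      a (N + t + m')          ≈⟨ ≈-sym (periodicFrom-iterate periodic N' (≤-trans (m≤m+n N t) (m≤m+n (N + t) m'))) ⟩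
      a (N + t + m' + N' * m) ≡⟨ cong a (xy∙z≈xz∙y (N + t) m' (N' * m)) ⟩
      a (N + t + N' * m + m') ≈⟨ p' _ (≤-trans (m≤m*n N' m) (m≤n+m (N' * m) (N + t))) ⟩
      a (N + t + N' * m)      ≈⟨ periodicFrom-iterate periodic N' (m≤m+n N t) ⟩
      a (N + t)               ∎

  period-exists : Decidable _≈_ → ∀ {a m} → EventuallyPeriodic R a m → ∃ (IsPeriodOf R a)
  period-exists _≈?_ {a} {m} (0<m , N , p) =
    least-period (least-satisfying candidate? (0<m , periodicFrom⇒periodicOnWindow p))
    where
    instance m≢0 : NonZero m
             m≢0 = >-nonZero 0<m
    open Window p
    Candidate : ℕ → Set
    Candidate m' = 0 < m' × PeriodicOnWindow m'
    candidate? : U.Decidable Candidate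
    candidate? m' = (0 <? m') ×-dec periodicOnWindow? _≈?_ m'
    least-period : ∃ (Least Candidate) → ∃ (IsPeriodOf R a)
    least-period (ρ , (0<ρ , wρ) , minimal) =
      ρ , (0<ρ , N , periodicOnWindow⇒periodicFrom wρ) ,
      λ m' (0<m' , _ , p') → minimal m' (0<m' , periodicFrom⇒periodicOnWindow p')

module DirectProduct (R S : CommutativeRing 0ℓ 0ℓ) where
  private
    module R = CommutativeRing R
    module S = CommutativeRing S
    module PR = Periodicity R
    module PS = Periodicity S

  R×S : CommutativeRing 0ℓ 0ℓ
  R×S = DP.commutativeRing R S

  open CommutativeRing R×S using () renaming (_*_ to _·_)
  open Periodicity R×S using (period-unique)

  finSum-proj₁ : ∀ {k} (f : Fin k → R.Carrier × S.Carrier) → proj₁ (finSum R×S f) ≡ finSum R (proj₁ ∘ f)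
  finSum-proj₁ {zero}  f = refl
  finSum-proj₁ {suc k} f = cong (proj₁ (f fzero) R.+_) (finSum-proj₁ (f ∘ fsuc))

  finSum-proj₂ : ∀ {k} (f : Fin k → R.Carrier × S.Carrier) → proj₂ (finSum R×S f) ≡ finSum S (proj₂ ∘ f)
  finSum-proj₂ {zero}  f = refl
  finSum-proj₂ {suc k} f = cong (proj₂ (f fzero) S.+_) (finSum-proj₂ (f ∘ fsuc))

  leadUnit-proj : ∀ k {c} → LeadUnit R×S k c → LeadUnit R k (proj₁ ∘ c) × LeadUnit S k (proj₂ ∘ c)
  leadUnit-proj (suc k) ((y₁ , y₂) , (cy≈1₁ , cy≈1₂)) = (y₁ , cy≈1₁) , (y₂ , cy≈1₂)

  leadUnit-pair : ∀ k {c₁ c₂} → LeadUnit R k c₁ → LeadUnit S k c₂ → LeadUnit R×S k < c₁ , c₂ >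
  leadUnit-pair (suc k) (y₁ , cy≈1₁) (y₂ , cy≈1₂) = (y₁ , y₂) , (cy≈1₁ , cy≈1₂)

  linRec-proj : ∀ {k a} → SatisfiesLinRec R×S k a →
    SatisfiesLinRec R k (proj₁ ∘ a) × SatisfiesLinRec S k (proj₂ ∘ a)
  linRec-proj {k} {a} (c , unit , rec) =
    (proj₁ ∘ c , proj₁ (leadUnit-proj k unit) , λ n → R.trans (proj₁ (rec n)) (R.reflexive (finSum-proj₁ (terms n)))) ,
    (proj₂ ∘ c , proj₂ (leadUnit-proj k unit) , λ n → S.trans (proj₂ (rec n)) (S.reflexive (finSum-proj₂ (terms n))))
    where
    terms : ℕ → Fin k → R.Carrier × S.Carrier
    terms n i = c i · a (n + toℕ i)

  linRec-pair : ∀ {k a₁ a₂} → SatisfiesLinRec R k a₁ → SatisfiesLinRec S k a₂ → SatisfiesLinRec R×S k < a₁ , a₂ >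
  linRec-pair {k} {a₁} {a₂} (c₁ , unit₁ , rec₁) (c₂ , unit₂ , rec₂) =
    < c₁ , c₂ > , leadUnit-pair k unit₁ unit₂ , λ n →
      R.trans (rec₁ n) (R.reflexive (sym (finSum-proj₁ (terms n)))) ,
      S.trans (rec₂ n) (S.reflexive (sym (finSum-proj₂ (terms n))))
    where
    terms : ℕ → Fin k → R.Carrier × S.Carrier
    terms n i = < c₁ , c₂ > i · < a₁ , a₂ > (n + toℕ i)

  periodic-proj : ∀ {a m} → EventuallyPeriodic R×S a m →
    EventuallyPeriodic R (proj₁ ∘ a) m × EventuallyPeriodic S (proj₂ ∘ a) m
  periodic-proj (0<m , N , p) = (0<m , N , λ n le → proj₁ (p n le)) , (0<m , N , λ n le → proj₂ (p n le))

  periodic-pair : ∀ {a₁ a₂ m} → EventuallyPeriodic R a₁ m → EventuallyPeriodic S a₂ m →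
    EventuallyPeriodic R×S < a₁ , a₂ > m
  periodic-pair (0<m , N₁ , p₁) (_ , N₂ , p₂) =
    0<m , N₁ ⊔ N₂ , λ n le → p₁ n (m⊔n≤o⇒m≤o N₁ N₂ le) , p₂ n (m⊔n≤o⇒n≤o N₁ N₂ le)

  period-pair : ∀ {a₁ a₂ ρ₁ ρ₂} → IsPeriodOf R a₁ ρ₁ → IsPeriodOf S a₂ ρ₂ →
    IsPeriodOf R×S < a₁ , a₂ > (lcm ρ₁ ρ₂)
  period-pair {a₁} {a₂} {ρ₁} {ρ₂} per₁@(periodic₁ , _) per₂@(periodic₂ , _) =
    periodic-pair (PR.periodic-multiple periodic₁ (m∣lcm[m,n] ρ₁ ρ₂) 0<lcm)
                  (PS.periodic-multiple periodic₂ (n∣lcm[m,n] ρ₁ ρ₂) 0<lcm) ,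
    λ m' periodic → lcm-below m' periodic (periodic-proj periodic)
    where
    0<lcm = lcm-positive (proj₁ periodic₁) (proj₁ periodic₂)
    lcm-below : ∀ m' → EventuallyPeriodic R×S < a₁ , a₂ > m' →
                EventuallyPeriodic R a₁ m' × EventuallyPeriodic S a₂ m' → lcm ρ₁ ρ₂ ≤ m'
    lcm-below m' (0<m' , _) (periodic₁' , periodic₂') =
      ∣⇒≤ {{>-nonZero 0<m'}} (lcm-least (PR.period-divides per₁ periodic₁') (PS.period-divides per₂ periodic₂'))

  ≈-dec-pair : Decidable R._≈_ → Decidable S._≈_ → Decidable (CommutativeRing._≈_ R×S)
  ≈-dec-pair _≈R?_ _≈S?_ (x₁ , x₂) (y₁ , y₂) = (x₁ ≈R? y₁) ×-dec (x₂ ≈S? y₂)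

  InP-pair : Decidable R._≈_ → Decidable S._≈_ → ∀ k m →
    InP R×S k m ⇔ ∃₂ λ ρ₁ ρ₂ → InP R k ρ₁ × InP S k ρ₂ × m ≡ lcm ρ₁ ρ₂
  InP-pair _≈R?_ _≈S?_ k m = mk⇔ split join
    where
    split : InP R×S k m → ∃₂ λ ρ₁ ρ₂ → InP R k ρ₁ × InP S k ρ₂ × m ≡ lcm ρ₁ ρ₂
    split (a , rec , per@(periodic , _))
      with PR.period-exists _≈R?_ (proj₁ (periodic-proj periodic))
         | PS.period-exists _≈S?_ (proj₂ (periodic-proj periodic))
    ... | ρ₁ , per₁ | ρ₂ , per₂ =
      ρ₁ , ρ₂ , (proj₁ ∘ a , proj₁ (linRec-proj {a = a} rec) , per₁) ,
                (proj₂ ∘ a , proj₂ (linRec-proj {a = a} rec) , per₂) ,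
      period-unique per (period-pair per₁ per₂)
    join : (∃₂ λ ρ₁ ρ₂ → InP R k ρ₁ × InP S k ρ₂ × m ≡ lcm ρ₁ ρ₂) → InP R×S k m
    join (_ , _ , (a₁ , rec₁ , per₁) , (a₂ , rec₂ , per₂) , refl) =
      < a₁ , a₂ > , linRec-pair {a₁ = a₁} {a₂} rec₁ rec₂ , period-pair per₁ per₂

finiteField-≈-dec : (F : FiniteField) → Decidable (CommutativeRing._≈_ (FiniteField.ring F))
finiteField-≈-dec F x y with enum-surj x | enum-surj y
  where open FiniteField F
... | i , i↦x | j , j↦y =
  map′ (λ i≡j → ≈-trans (≈-sym i↦x) (≈-trans (reflexive (cong enum i≡j)) j↦y))
       (λ x≈y → enum-inj i j (≈-trans i↦x (≈-trans x≈y (≈-sym j↦y))))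
       (i Fin.≟ j)
  where
  open FiniteField F
  open CommutativeRing ring using (reflexive) renaming (sym to ≈-sym; trans to ≈-trans)

⨁-≈-dec : ∀ {r} (F : Fin (suc r) → FiniteField) → Decidable (CommutativeRing._≈_ (⨁ F))
⨁-≈-dec {zero}  F = finiteField-≈-dec (F fzero)
⨁-≈-dec {suc r} F = DirectProduct.≈-dec-pair (FiniteField.ring (F fzero)) (⨁ (F ∘ fsuc))
                                              (finiteField-≈-dec (F fzero)) (⨁-≈-dec (F ∘ fsuc))

lemma4p2 : (r : ℕ) (F : Fin (suc r) → FiniteField) (k : ℕ) → 1 ≤ k → (m : ℕ) →
    InP (⨁ F) k m ⇔ (∃ λ (ω : Fin (suc r) → ℕ) → (∀ i → InP (FiniteField.ring (F i)) k (ω i)) × m ≡ lcmAll ω)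
-- The hypothesis 1 ≤ k is only passed on: for k = 0 no sequence satisfies a recurrence, so both
-- sides are empty.
lemma4p2 zero F k _ m = mk⇔
  (λ m∈P → (λ _ → m) , (λ { fzero → m∈P }) , sym (lcm[n,1]≡n m))
  (λ (ω , ω∈P , m≡lcm) → subst (InP (⨁ F) k) (sym (trans m≡lcm (lcm[n,1]≡n (ω fzero)))) (ω∈P fzero))
lemma4p2 (suc r) F k 1≤k m =
  ⇔.trans (DirectProduct.InP-pair (FiniteField.ring (F fzero)) (⨁ (F ∘ fsuc))
                                  (finiteField-≈-dec (F fzero)) (⨁-≈-dec (F ∘ fsuc)) k m)
          (mk⇔ to from)
  where
  IH = lemma4p2 r (F ∘ fsuc) k 1≤k
  to : (∃₂ λ ρ₁ ρ₂ → InP (FiniteField.ring (F fzero)) k ρ₁ × InP (⨁ (F ∘ fsuc)) k ρ₂ × m ≡ lcm ρ₁ ρ₂) →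
       ∃ λ ω → (∀ i → InP (FiniteField.ring (F i)) k (ω i)) × m ≡ lcmAll ω
  to (ρ₁ , ρ₂ , ρ₁∈P , ρ₂∈P , m≡lcm) with Equivalence.to (IH ρ₂) ρ₂∈P
  ... | ω , ω∈P , ρ₂≡lcmAll =
    ρ₁ ∷ ω , (λ { fzero → ρ₁∈P ; (fsuc i) → ω∈P i }) , trans m≡lcm (cong (lcm ρ₁) ρ₂≡lcmAll)
  from : (∃ λ ω → (∀ i → InP (FiniteField.ring (F i)) k (ω i)) × m ≡ lcmAll ω) →
         ∃₂ λ ρ₁ ρ₂ → InP (FiniteField.ring (F fzero)) k ρ₁ × InP (⨁ (F ∘ fsuc)) k ρ₂ × m ≡ lcm ρ₁ ρ₂
  from (ω , ω∈P , m≡lcmAll) =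
    ω fzero , lcmAll (ω ∘ fsuc) , ω∈P fzero , Equivalence.from (IH _) (ω ∘ fsuc , ω∈P ∘ fsuc , refl) , m≡lcmAll
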